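{- For positive integers $k_1,\dots,k_l$, $$\mathcal{D}_q Li^t_{(k_1, k_2, \ldots, k_l); q}(z) = \begin{cases} \frac{1}{z}Li^t_{(k_1-1, k_2, \ldots, k_l); q}(z), & k_1 \ge 2, \\ \left( \frac{t}{z} + \frac{1}{1-z}\right) Li^t_{(k_2, \ldots, k_l); q}(z), & k_1=1,\ l \ge 2, \\ \frac{1}{1-z}, & k_1 = l=1. \end{cases}$$
   Context: $q$ is a formal parameter, $[n]=(1-q^n)/(1-q)$. For an index $\mathbf k=(k_1,\dots,k_l)$ of positive integers, $Li_{\mathbf k;q}(z)=\sum_{m_1>\cdots>m_l\ge1}\frac{z^{m_1}}{[m_1]^{k_1}\cdots[m_l]^{k_l}}$ and $Li^t_{\mathbf k;q}(z)=\sum_{\mathbf p}Li_{\mathbf p;q}(z)t^{l-\mathrm{dep}(\mathbf p)}$, where $\mathbf p$ runs over all indices of the form $(k_1\,\square\cdots\square\,k_l)$ with each $\square$ filled by ``$,$'' or ``$+$'' and $\mathrm{dep}$ is the length. $\mathcal D_q$ is the $q$-difference operator $(\mathcal D_q f)(z)=\frac{f(z)-f(qz)}{(1-q)z}$. -}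

module Defs where

open import Level using (Level)
open import Algebra.Bundles using (CommutativeRing)
open import Data.Nat using (ℕ; zero; suc; _∸_) renaming (_+_ to _+ℕ_)
open import Data.List using (List; []; _∷_; map; _++_; length)

-- Formal power series in z with coefficients in a commutative ring R
-- (R should be thought of as e.g. ℚ(q)[t]); the series is given by its
-- coefficient sequence: (f n) = coefficient of z^n.
module QMZV {c ℓ : Level} (R : CommutativeRing c ℓ)
            (q t : CommutativeRing.Carrier R)
            -- inv n is the inverse of [n+1] (see the hypothesis in Statement)
            (inv : ℕ → CommutativeRing.Carrier R) where

  open CommutativeRing R using (Carrier; _≈_; _+_; _*_; 0#; 1#)

  Series : Set c
  Series = ℕ → Carrier

  _≈ₛ_ : Series → Series → Set ℓ
  f ≈ₛ g = ∀ n → f n ≈ g n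

  pow : Carrier → ℕ → Carrier
  pow x zero    = 1#
  pow x (suc n) = x * pow x n

  -- q-integer [n] = 1 + q + ... + q^(n-1) = (1 - q^n)/(1 - q)
  qnum : ℕ → Carrier
  qnum zero    = 0#
  qnum (suc n) = 1# + q * qnum n

  -- 1/[m] for m ≥ 1 (value at 0 is irrelevant: never used for m = 0)
  invq : ℕ → Carrier
  invq zero    = 0#
  invq (suc n) = inv n

  sumBelow : (ℕ → Carrier) → ℕ → Carrier
  sumBelow f zero          = 0#
  sumBelow f (suc zero)    = 0#
  sumBelow f (suc (suc n)) = sumBelow f (suc n) + f (suc n)

  -- top k N = Σ_{N = m₁ > m₂ > ⋯ > m_l ≥ 1} Π 1/[m_i]^{k_i}  (for k = (k₁,…,k_l))
  -- bot k N = Σ_{N > m₁ > ⋯ > m_l ≥ 1} Π 1/[m_i]^{k_i}     (bot [] N = 1)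
  top : ℕ → List ℕ → ℕ → Carrier
  bot : List ℕ → ℕ → Carrier
  top k ks N = pow (invq N) k * bot ks N
  bot []       N = 1#
  bot (k ∷ ks) N = sumBelow (top k ks) N

  -- Li_{k;q}(z) = Σ_{m₁ > ⋯ > m_l ≥ 1} z^{m₁} / ([m₁]^{k₁} ⋯ [m_l]^{k_l})
  Li : List ℕ → Series
  Li []       n       = 1#   -- empty index (not used in the statement)
  Li (k ∷ ks) zero    = 0#
  Li (k ∷ ks) (suc n) = top k ks (suc n)

  -- all indices (k₁ □ ⋯ □ k_l), each □ being "," or "+"
  glue : ℕ → List ℕ → List (List ℕ)
  glue acc []       = (acc ∷ []) ∷ []
  glue acc (k ∷ ks) = map (acc ∷_) (glue k ks) ++ glue (acc +ℕ k) ks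

  gluings : List ℕ → List (List ℕ)
  gluings []       = [] ∷ []
  gluings (k ∷ ks) = glue k ks

  sumSeries : List Series → Series
  sumSeries []       n = 0#
  sumSeries (f ∷ fs) n = f n + sumSeries fs n

  -- Li^t_{k;q}(z) = Σ_p Li_{p;q}(z) t^{l - dep p}
  Lit : List ℕ → Series
  Lit k = sumSeries (map (λ p n → pow t (length k ∸ length p) * Li p n) (gluings k))

  -- q-difference operator (D_q f)(z) = (f(z) - f(qz)) / ((1-q) z), computed
  -- coefficientwise: the coefficient of z^(n+1) is multiplied by
  -- (1 - q^(n+1))/(1 - q) = [n+1] and shifted down to z^n.
  Dq : Series → Series
  Dq f n = qnum (suc n) * f (suc n)

  -- (1/z) f   (for f with vanishing constant term)
  divz : Series → Series
  divz f n = f (suc n)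

  -- (1/(1-z)) f : coefficient n is Σ_{j ≤ n} f j
  div1mz : Series → Series
  div1mz f zero    = f zero
  div1mz f (suc n) = div1mz f n + f (suc n)

  -- 1/(1-z) = Σ_{n ≥ 0} z^n
  geom : Series
  geom n = 1#

module Submission where

-- The coefficient of z^N in Li^t_{k;q}(z) is a finite sum, over the gluings p
-- of k, of t^{l - dep p} · Li_{p;q}[N].  Applying D_q multiplies the
-- coefficient of z^{n+1} by [n+1], and [N] · 1/[N]^{a+1} = 1/[N]^a.  Since the
-- gluings of (a+1, k₂, …) are exactly those of (a, k₂, …) with the first entry
-- raised by one (glue-suc), D_q lowers the first entry of every gluing at once
-- (Dq-Lit-lowers-head).  The three cases then follow:
--   * k₁ ≥ 2: the lowered sum is the coefficient of Li^t_{(k₁-1,…)}, shifted;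
--   * k₁ = 1, l ≥ 2: the gluings of (0, k₂, …) are those starting with 0 — for
--     which 1/[N]^0 = 1 turns the top summation into a partial sum, i.e. the
--     operator 1/(1-z) — and those of (k₂, …) carrying one extra factor t;
--   * k₁ = l = 1: the only term is 1/[N]^0 = 1.
-- The file first treats the combinatorics of gluings, then finite sums in a
-- commutative ring, then the q-analytic facts, and finally the theorem.

open import Defs
open import Algebra.Bundles using (CommutativeRing)
open import Data.Nat using (ℕ; suc; _≤_; _∸_)
open import Data.List using (List; []; _∷_)
open import Data.List.Relation.Unary.All using (All)
open import Data.Product using (_×_)
open import Relation.Binary.PropositionalEquality using (_≡_; _≢_)

open import Level using (Level)
open import Data.Nat using (zero; z≤n; s≤s) renaming (_+_ to _+ℕ_)
open import Data.Nat.Properties using (m≤n⇒m≤1+n; +-∸-assoc)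
open import Data.List using (map; _++_; length)
open import Data.List.Properties using (map-++; map-∘)
open import Data.Product using (_,_)
open import Data.List.Relation.Unary.All using ([]; _∷_)
import Data.List.Relation.Unary.All as All
open import Data.List.Relation.Unary.All.Properties using (map⁺; ++⁺)
import Relation.Binary.PropositionalEquality as P
import Relation.Binary.Reasoning.Setoid as SetoidReasoning
import Algebra.Properties.CommutativeSemigroup as CommSemigroupProperties
open import Data.Empty using (⊥-elim)

-- Combinatorics of gluings.  (The function glue is defined inside the
-- parametrised module QMZV, so the module takes its parameters, but nothing
-- here depends on them.)
module Gluing {c ℓ : Level} (R : CommutativeRing c ℓ) (q t : CommutativeRing.Carrier R)
              (inv : ℕ → CommutativeRing.Carrier R) where
  open QMZV R q t inv using (glue)

  incHead : List ℕ → List ℕ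
  incHead []       = []
  incHead (a ∷ ps) = suc a ∷ ps

  glue-suc : ∀ acc ks → glue (suc acc) ks ≡ map incHead (glue acc ks)
  glue-suc acc []       = P.refl
  glue-suc acc (k ∷ ks) = P.trans
    (P.cong₂ _++_ (map-∘ (glue k ks)) (glue-suc (acc +ℕ k) ks))
    (P.sym (map-++ incHead (map (acc ∷_) (glue k ks)) (glue (acc +ℕ k) ks)))

  data IsCons : List ℕ → Set where
    cons : ∀ a ps → IsCons (a ∷ ps)

  glue-cons : ∀ acc ks → All IsCons (glue acc ks)
  glue-cons acc []       = cons acc [] ∷ []
  glue-cons acc (k ∷ ks) =
    ++⁺ (map⁺ (All.tabulate (λ {p} _ → cons acc p))) (glue-cons (acc +ℕ k) ks)

  glue-length : ∀ acc ks → All (λ p → length p ≤ suc (length ks)) (glue acc ks)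
  glue-length acc []       = s≤s z≤n ∷ []
  glue-length acc (k ∷ ks) =
    ++⁺ (map⁺ (All.map s≤s (glue-length k ks)))
        (All.map m≤n⇒m≤1+n (glue-length (acc +ℕ k) ks))

module ListSums {c ℓ : Level} (R : CommutativeRing c ℓ) where
  open CommutativeRing R
  open SetoidReasoning setoid
  open CommSemigroupProperties +-commutativeSemigroup using (interchange)

  sumOver : ∀ {A : Set} → List A → (A → Carrier) → Carrier
  sumOver []      f = 0#
  sumOver (x ∷ X) f = f x + sumOver X f

  sumOver-++ : ∀ {A : Set} (X Y : List A) f →
               sumOver (X ++ Y) f ≈ sumOver X f + sumOver Y f
  sumOver-++ []      Y f = sym (+-identityˡ _)
  sumOver-++ (x ∷ X) Y f = trans (+-congˡ (sumOver-++ X Y f)) (sym (+-assoc _ _ _))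

  sumOver-map : ∀ {A B : Set} (h : A → B) X f →
                sumOver (map h X) f ≡ sumOver X (λ p → f (h p))
  sumOver-map h []      f = P.refl
  sumOver-map h (x ∷ X) f = P.cong (f (h x) +_) (sumOver-map h X f)

  sumOver-cong : ∀ {A : Set} {Q : A → Set} {f g : A → Carrier} →
                 (∀ {p} → Q p → f p ≈ g p) → ∀ X → All Q X →
                 sumOver X f ≈ sumOver X g
  sumOver-cong f≈g []      []        = refl
  sumOver-cong f≈g (x ∷ X) (qx ∷ qX) = +-cong (f≈g qx) (sumOver-cong f≈g X qX)

  *-sumOver : ∀ {A : Set} a (X : List A) f →
              a * sumOver X f ≈ sumOver X (λ p → a * f p)
  *-sumOver a []      f = zeroʳ a
  *-sumOver a (x ∷ X) f = trans (distribˡ a _ _) (+-congˡ (*-sumOver a X f))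

  sumOver-+ : ∀ {A : Set} (X : List A) f g →
              sumOver X f + sumOver X g ≈ sumOver X (λ p → f p + g p)
  sumOver-+ []      f g = +-identityˡ _
  sumOver-+ (x ∷ X) f g =
    trans (interchange (f x) _ (g x) _) (+-congˡ (sumOver-+ X f g))

module Proof {c ℓ : Level} (R : CommutativeRing c ℓ) (q t : CommutativeRing.Carrier R)
             (inv : ℕ → CommutativeRing.Carrier R) where
  open CommutativeRing R hiding (zero)
  open QMZV R q t inv
  open SetoidReasoning setoid
  open CommSemigroupProperties *-commutativeSemigroup using (x∙yz≈y∙xz)
  open ListSums R
  open Gluing R q t inv

  weight : ℕ → List ℕ → Series
  weight m p j = pow t (m ∸ length p) * Li p j

  Lit-coeff : ∀ k j → Lit k j ≡ sumOver (gluings k) (λ p → weight (length k) p j)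
  Lit-coeff k j = go (gluings k)
    where
    go : ∀ X → sumSeries (map (weight (length k)) X) j
                 ≡ sumOver X (λ p → weight (length k) p j)
    go []      = P.refl
    go (p ∷ X) = P.cong (weight (length k) p j +_) (go X)

  weight-suc : ∀ {m p} → length p ≤ m → ∀ j → weight (suc m) p j ≈ t * weight m p j
  weight-suc p≤m j = trans
    (*-congʳ (reflexive (P.cong (pow t) (+-∸-assoc 1 p≤m))))
    (*-assoc t _ _)

  div1mz-cong : ∀ {f g} → f ≈ₛ g → ∀ n → div1mz f n ≈ div1mz g n
  div1mz-cong f≈g zero    = f≈g zero
  div1mz-cong f≈g (suc n) = +-cong (div1mz-cong f≈g n) (f≈g (suc n))

  div1mz-scale : ∀ a f n → div1mz (λ j → a * f j) n ≈ a * div1mz f n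
  div1mz-scale a f zero    = refl
  div1mz-scale a f (suc n) =
    trans (+-congʳ (div1mz-scale a f n)) (sym (distribˡ a _ _))

  div1mz-sumOver : ∀ X (F : List ℕ → Series) n →
    div1mz (λ j → sumOver X (λ p → F p j)) n ≈ sumOver X (λ p → div1mz (F p) n)
  div1mz-sumOver X F zero    = refl
  div1mz-sumOver X F (suc n) = trans (+-congʳ (div1mz-sumOver X F n)) (sumOver-+ X _ _)

  div1mz-Li : ∀ {p} → IsCons p → ∀ n → div1mz (Li p) n ≈ bot p (suc n)
  div1mz-Li (cons a ps) zero    = refl
  div1mz-Li (cons a ps) (suc n) = +-congʳ (div1mz-Li (cons a ps) n)

  module WithInverses (inverse : ∀ n → qnum (suc n) * inv n ≈ 1#) where

    -- [N] · 1/[N]^{a+1} = 1/[N]^a, on the top summation variable m₁ = N.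
    qnum-Li-incHead : ∀ {p} → IsCons p → ∀ n →
                      qnum (suc n) * Li (incHead p) (suc n) ≈ Li p (suc n)
    qnum-Li-incHead (cons a ps) n = begin
      qnum (suc n) * ((inv n * pow (inv n) a) * bot ps (suc n))
        ≈⟨ *-congˡ (*-assoc _ _ _) ⟩
      qnum (suc n) * (inv n * (pow (inv n) a * bot ps (suc n)))
        ≈⟨ sym (*-assoc _ _ _) ⟩
      (qnum (suc n) * inv n) * (pow (inv n) a * bot ps (suc n))
        ≈⟨ *-congʳ (inverse n) ⟩
      1# * (pow (inv n) a * bot ps (suc n))
        ≈⟨ *-identityˡ _ ⟩
      pow (inv n) a * bot ps (suc n) ∎

    Dq-Lit-lowers-head : ∀ a ks n →
      Dq (Lit (suc a ∷ ks)) n ≈ sumOver (glue a ks) (λ p → weight (suc (length ks)) p (suc n))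
    Dq-Lit-lowers-head a ks n = begin
      [N] * Lit (suc a ∷ ks) (suc n)
        ≡⟨ P.cong ([N] *_) (Lit-coeff (suc a ∷ ks) (suc n)) ⟩
      [N] * sumOver (glue (suc a) ks) w
        ≡⟨ P.cong (λ X → [N] * sumOver X w) (glue-suc a ks) ⟩
      [N] * sumOver (map incHead (glue a ks)) w
        ≡⟨ P.cong ([N] *_) (sumOver-map incHead (glue a ks) w) ⟩
      [N] * sumOver (glue a ks) (λ p → w (incHead p))
        ≈⟨ *-sumOver [N] (glue a ks) _ ⟩
      sumOver (glue a ks) (λ p → [N] * w (incHead p))
        ≈⟨ sumOver-cong lower (glue a ks) (glue-cons a ks) ⟩
      sumOver (glue a ks) w ∎
      where
      [N] : Carrier
      [N] = qnum (suc n)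
      w : List ℕ → Carrier
      w p = weight (suc (length ks)) p (suc n)
      lower : ∀ {p} → IsCons p → [N] * w (incHead p) ≈ w p
      lower isCons@(cons _ _) = trans
        (x∙yz≈y∙xz [N] _ _)
        (*-congˡ (qnum-Li-incHead isCons n))

    case-head≥2 : ∀ a ks n → Dq (Lit (suc (suc a) ∷ ks)) n ≈ divz (Lit (suc a ∷ ks)) n
    case-head≥2 a ks n = trans
      (Dq-Lit-lowers-head (suc a) ks n)
      (reflexive (P.sym (Lit-coeff (suc a ∷ ks) (suc n))))

    -- Case k₁ = 1, l ≥ 2: gluings of (0, k, …) either start with 0 (giving
    -- the partial sums, i.e. 1/(1-z)) or are gluings of (k, …) (giving t/z).
    case-head≡1 : ∀ k ks n →
      Dq (Lit (1 ∷ k ∷ ks)) n ≈ t * divz (Lit (k ∷ ks)) n + div1mz (Lit (k ∷ ks)) n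
    case-head≡1 k ks n = begin
      Dq (Lit (1 ∷ k ∷ ks)) n
        ≈⟨ Dq-Lit-lowers-head 0 (k ∷ ks) n ⟩
      sumOver (map (0 ∷_) X ++ X) (w (suc m))
        ≈⟨ sumOver-++ (map (0 ∷_) X) X _ ⟩
      sumOver (map (0 ∷_) X) (w (suc m)) + sumOver X (w (suc m))
        ≈⟨ +-cong startingWith0 gluingsOfTail ⟩
      div1mz (Lit (k ∷ ks)) n + t * divz (Lit (k ∷ ks)) n
        ≈⟨ +-comm _ _ ⟩
      t * divz (Lit (k ∷ ks)) n + div1mz (Lit (k ∷ ks)) n ∎
      where
      X : List (List ℕ)
      X = glue k ks
      m : ℕ
      m = suc (length ks)
      w : ℕ → List ℕ → Carrier
      w m' p = weight m' p (suc n)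

      startingWith0 : sumOver (map (0 ∷_) X) (w (suc m)) ≈ div1mz (Lit (k ∷ ks)) n
      startingWith0 = begin
        sumOver (map (0 ∷_) X) (w (suc m))
          ≡⟨ sumOver-map (0 ∷_) X _ ⟩
        sumOver X (λ p → pow t (m ∸ length p) * (1# * bot p (suc n)))
          ≈⟨ sumOver-cong asPartialSum X (glue-cons k ks) ⟩
        sumOver X (λ p → div1mz (weight m p) n)
          ≈⟨ sym (div1mz-sumOver X (weight m) n) ⟩
        div1mz (λ j → sumOver X (λ p → weight m p j)) n
          ≈⟨ div1mz-cong (λ j → reflexive (P.sym (Lit-coeff (k ∷ ks) j))) n ⟩
        div1mz (Lit (k ∷ ks)) n ∎
        where
        asPartialSum : ∀ {p} → IsCons p →
          pow t (m ∸ length p) * (1# * bot p (suc n)) ≈ div1mz (weight m p) n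
        asPartialSum {p} isCons = begin
          pow t (m ∸ length p) * (1# * bot p (suc n))
            ≈⟨ *-congˡ (*-identityˡ _) ⟩
          pow t (m ∸ length p) * bot p (suc n)
            ≈⟨ *-congˡ (sym (div1mz-Li isCons n)) ⟩
          pow t (m ∸ length p) * div1mz (Li p) n
            ≈⟨ sym (div1mz-scale _ (Li p) n) ⟩
          div1mz (weight m p) n ∎

      gluingsOfTail : sumOver X (w (suc m)) ≈ t * divz (Lit (k ∷ ks)) n
      gluingsOfTail = begin
        sumOver X (w (suc m))
          ≈⟨ sumOver-cong (λ {p} p≤m → weight-suc {p = p} p≤m (suc n)) X (glue-length k ks) ⟩
        sumOver X (λ p → t * w m p)
          ≈⟨ sym (*-sumOver t X _) ⟩
        t * sumOver X (w m)
          ≡⟨ P.cong (t *_) (P.sym (Lit-coeff (k ∷ ks) (suc n))) ⟩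
        t * divz (Lit (k ∷ ks)) n ∎

    -- Case k₁ = l = 1: the single gluing (0) contributes 1/[N]^0 = 1.
    case-single : ∀ n → Dq (Lit (1 ∷ [])) n ≈ 1#
    case-single n = begin
      Dq (Lit (1 ∷ [])) n            ≈⟨ Dq-Lit-lowers-head 0 [] n ⟩
      1# * (1# * 1#) + 0#            ≈⟨ +-identityʳ _ ⟩
      1# * (1# * 1#)                 ≈⟨ *-identityˡ _ ⟩
      1# * 1#                        ≈⟨ *-identityˡ _ ⟩
      1# ∎

lemma3p1 : ∀ {c ℓ} (R : CommutativeRing c ℓ) (q t : CommutativeRing.Carrier R)
    (inv : ℕ → CommutativeRing.Carrier R) →
    let open CommutativeRing R
        open QMZV R q t inv in
    (∀ n → qnum (suc n) * inv n ≈ 1#) →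
    (k₁ : ℕ) (ks : List ℕ) → 1 ≤ k₁ → All (1 ≤_) ks →
    (2 ≤ k₁ → Dq (Lit (k₁ ∷ ks)) ≈ₛ divz (Lit (k₁ ∸ 1 ∷ ks)))
    × (k₁ ≡ 1 → ks ≢ [] →
    Dq (Lit (k₁ ∷ ks)) ≈ₛ (λ n → t * divz (Lit ks) n + div1mz (Lit ks) n))
    × (k₁ ≡ 1 → ks ≡ [] → Dq (Lit (k₁ ∷ ks)) ≈ₛ geom)
lemma3p1 R q t inv inverse k₁ ks _ _ = head≥2 k₁ , head≡1 ks , single ks
  where
  open CommutativeRing R hiding (zero)
  open QMZV R q t inv
  open Proof.WithInverses R q t inv inverse

  head≥2 : ∀ k₁ → 2 ≤ k₁ → Dq (Lit (k₁ ∷ ks)) ≈ₛ divz (Lit (k₁ ∸ 1 ∷ ks))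
  head≥2 (suc zero)    (s≤s ())
  head≥2 (suc (suc a)) _ = case-head≥2 a ks

  head≡1 : ∀ ks → k₁ ≡ 1 → ks ≢ [] →
           Dq (Lit (k₁ ∷ ks)) ≈ₛ (λ n → t * divz (Lit ks) n + div1mz (Lit ks) n)
  head≡1 []       _      ks≢[] = ⊥-elim (ks≢[] P.refl)
  head≡1 (k ∷ ks) P.refl _     = case-head≡1 k ks

  single : ∀ ks → k₁ ≡ 1 → ks ≡ [] → Dq (Lit (k₁ ∷ ks)) ≈ₛ geom
  single .[] P.refl P.refl = case-single
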